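{- Let $G$ be a graph and $f:G\to G$ a graph morphism such that $f\text{ --- }\mathrm{id}_G$ is an edge of $G^G$. Then $G$ is homotopy equivalent to $\mathrm{Im}(f)$.
   Context: A graph is a finite undirected graph, loops allowed, at most one edge between two vertices; a graph morphism is a vertex map preserving edges. The exponential graph $H^G$ has as vertices the set maps $V(G)\to V(H)$, with $f\text{ --- }g$ iff $f(v_1)\text{ --- }g(v_2)$ for every edge $v_1\text{ --- }v_2$ of $G$ (loops included). Morphisms $f,g:G\to H$ are homotopic if there is a sequence of graph morphisms $f=f_0,\dots,f_n=g$ with $f_i\text{ --- }f_{i+1}$ in $H^G$. Graphs $G,H$ are homotopy equivalent if there are morphisms $f:G\to H$, $g:H\to G$ with $gf$ homotopic to $\mathrm{id}_G$ and $fg$ homotopic to $\mathrm{id}_H$. $\mathrm{Im}(f)$ is the subgraph of $G$ with vertex set $f(V(G))$ and edges $f(x)\text{ --- }f(y)$ for the edges $x\text{ --- }y$ of $G$. -}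

module Defs where

open import Data.Nat using (ℕ)
open import Data.Fin using (Fin; _≟_)
open import Data.Fin.Properties using (any?)
open import Data.Product using (Σ; ∃; _×_; _,_)
open import Function using (_∘_; id)
open import Relation.Nullary.Decidable using (True)
open import Relation.Binary.PropositionalEquality using (_≡_; _≗_)

-- A graph: vertex type with a symmetric edge relation (loops allowed;
-- the relation E x y means "there is an edge x --- y").
record Graph : Set₁ where
  field
    V     : Set
    E     : V → V → Set
    E-sym : ∀ {x y} → E x y → E y x
open Graph public

record FinGraph : Set₁ where
  field
    n     : ℕ
    Ed    : Fin n → Fin n → Set
    Ed-sym : ∀ {x y} → Ed x y → Ed y x
open FinGraph public

toGraph : FinGraph → Graph
toGraph G = record { V = Fin (n G) ; E = Ed G ; E-sym = Ed-sym G }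

IsMorphism : (G H : Graph) → (V G → V H) → Set
IsMorphism G H f = ∀ {x y} → E G x y → E H (f x) (f y)

ExpAdj : (G H : Graph) → (V G → V H) → (V G → V H) → Set
ExpAdj G H f g = ∀ {v₁ v₂} → E G v₁ v₂ → E H (f v₁) (g v₂)

data Homotopic (G H : Graph) : (V G → V H) → (V G → V H) → Set where
  done : ∀ {f g} → f ≗ g → Homotopic G H f g
  step : ∀ {f g} (h : V G → V H) → IsMorphism G H h → ExpAdj G H f h →
         Homotopic G H h g → Homotopic G H f g

HomotopyEquivalent : Graph → Graph → Set
HomotopyEquivalent G H =
  Σ (V G → V H) λ f → Σ (V H → V G) λ g →
    IsMorphism G H f × IsMorphism H G g ×
    Homotopic G G (g ∘ f) id × Homotopic H H (f ∘ g) id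

-- vertex set f(V(G)) (membership is a decidable, proof-irrelevant predicate)
InImage : {m : ℕ} → (Fin m → Fin m) → Fin m → Set
InImage f y = True (any? (λ x → f x ≟ y))

Im : (G : FinGraph) → (Fin (n G) → Fin (n G)) → Graph
Im G f = record
  { V = Σ (Fin (n G)) (InImage f)
  ; E = λ a b → ∃ λ x → ∃ λ y → Ed G x y × f x ≡ Σ.proj₁ a × f y ≡ Σ.proj₁ b
  ; E-sym = λ { (x , y , e , p , q) → y , x , Ed-sym G e , q , p }
  }

module Submission where

-- Write ι : Im(f) → G for the inclusion of vertices and f̂ : G → Im(f)
-- for the corestriction x ↦ f(x).  Then ι ∘ f̂ = f, which is adjacent to id_G,
-- and f̂ ∘ ι is the restriction of f to Im(f), which is adjacent to id_Im(f)
-- because every edge f(x) --- f(y) of Im(f) gives, via f --- id, an edge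
-- f(x) --- y of G and hence the edge f(f(x)) --- f(y) of Im(f).

open import Defs
open import Data.Fin using (Fin)
open import Data.Product using (_,_; proj₁)
open import Function using (id; _∘_)
open import Relation.Nullary.Decidable using (fromWitness)
open import Relation.Binary.PropositionalEquality using (refl; subst₂)

id-isMorphism : (G : Graph) → IsMorphism G G id
id-isMorphism G e = e

adjacent⇒homotopic : (G H : Graph) {f : V G → V H} (g : V G → V H) →
  IsMorphism G H g → ExpAdj G H f g → Homotopic G H f g
adjacent⇒homotopic G H g g-mor f-g = step g g-mor f-g (done λ _ → refl)

module _ (G : FinGraph) (f : Fin (n G) → Fin (n G)) where

  inclusion : V (Im G f) → Fin (n G)
  inclusion = proj₁

  corestriction : Fin (n G) → V (Im G f)
  corestriction x = f x , fromWitness (x , refl)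

  corestriction-isMorphism : IsMorphism (toGraph G) (Im G f) corestriction
  corestriction-isMorphism {x} {y} e = x , y , e , refl , refl

  inclusion-isMorphism : IsMorphism (toGraph G) (toGraph G) f →
    IsMorphism (Im G f) (toGraph G) inclusion
  inclusion-isMorphism f-mor (x , y , e , fx≡a , fy≡b) =
    subst₂ (Ed G) fx≡a fy≡b (f-mor e)

  -- If f --- id_G, then its restriction f̂ ∘ ι --- id_Im(f): for an edge
  -- a = f(x) --- f(y) = b of Im(f), the edge f(x) --- y of G maps to
  -- f(a) --- b in Im(f).
  restriction-adjacent-id : ExpAdj (toGraph G) (toGraph G) f id →
    ExpAdj (Im G f) (Im G f) (corestriction ∘ inclusion) id
  restriction-adjacent-id f-id {a} (x , y , e , fx≡a , fy≡b) =
    inclusion a , y , subst₂ (Ed G) fx≡a refl (f-id e) , refl , fy≡b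

-- Edge endpoints
-- are implicit in IsMorphism/ExpAdj and cannot be inferred from the
-- (non-injective) edge relations, so those proofs are passed eta-expanded.
lemma4p15 : (G : FinGraph) (f : Fin (n G) → Fin (n G)) →
    IsMorphism (toGraph G) (toGraph G) f →
    ExpAdj (toGraph G) (toGraph G) f id →
    HomotopyEquivalent (toGraph G) (Im G f)
lemma4p15 G f f-mor f-id =
  corestriction G f , inclusion G f ,
  (λ {x} {y} → corestriction-isMorphism G f {x} {y}) ,
  (λ {a} {b} → inclusion-isMorphism G f f-mor {a} {b}) ,
  -- ι ∘ f̂ = f --- id_G
  adjacent⇒homotopic (toGraph G) (toGraph G) id
    (λ {x} {y} → id-isMorphism (toGraph G) {x} {y}) f-id ,
  adjacent⇒homotopic (Im G f) (Im G f) id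
    (λ {a} {b} → id-isMorphism (Im G f) {a} {b})
    (λ {a} {b} → restriction-adjacent-id G f f-id {a} {b})
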